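{- Let $d\ge2$. There exists $N_0$ such that for all $N\ge N_0$ and all $\alpha,\beta\in\mathcal S_d$, the $(\alpha,\beta)$ entry of $M_d^N$ is positive, i.e. there is at least one walk of length $N$ in $\mathcal G_d$ from $\alpha$ to $\beta$.
   Context: For an integer $d\ge2$, let $\mathcal S_d=\{(i\bmod d, j\bmod d): \gcd(i,j,d)=1\}$. For $\alpha=(i,j)\in\mathcal S_d$ let $L(\alpha)=(i,i+j)$ and $R(\alpha)=(i+j,j)$ (entries mod $d$). $\mathcal G_d$ is the directed graph with vertex set $\mathcal S_d$ and edges $(\alpha,L(\alpha))$ and $(\alpha,R(\alpha))$ for each $\alpha\in\mathcal S_d$; $M_d$ is its $|\mathcal S_d|\times|\mathcal S_d|$ adjacency matrix with $m_{\alpha L(\alpha)}=m_{\alpha R(\alpha)}=1$ and all other entries $0$. -}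

module Defs where

open import Data.Nat using (ℕ; zero; suc; _+_; _*_; _≥_; NonZero)
open import Data.Nat.GCD using (gcd)
open import Data.Fin using (Fin; toℕ; fromℕ<)
open import Data.Fin.Properties using (_≟_)
open import Data.Nat.DivMod using (_%_; m%n<n)
open import Data.Nat.Properties using () renaming (_≟_ to _≟ℕ_)
open import Data.Product using (_×_; _,_; proj₁; proj₂)
open import Data.Nat.ListAction using (sum)
open import Data.List using (List; map; allFin; cartesianProduct)
open import Relation.Nullary using (yes; no)
open import Relation.Binary.PropositionalEquality using (_≡_)

Pair : ℕ → Set
Pair d = Fin d × Fin d

inS : ∀ {d} → Pair d → Set
inS {d} (i , j) = gcd (gcd (toℕ i) (toℕ j)) d ≡ 1

_⊕_ : ∀ {d} .{{_ : NonZero d}} → Fin d → Fin d → Fin d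
_⊕_ {d} i j = fromℕ< (m%n<n (toℕ i + toℕ j) d)

L : ∀ {d} .{{_ : NonZero d}} → Pair d → Pair d
L (i , j) = (i , i ⊕ j)

R : ∀ {d} .{{_ : NonZero d}} → Pair d → Pair d
R (i , j) = (i ⊕ j , j)

Vertex : ℕ → Set
Vertex d = Data.Product.Σ (Pair d) inS

-- Adjacency matrix M_d, indexed by S_d: m_{α L(α)} = m_{α R(α)} = 1, else 0.
-- (L α ≠ R α for α ∈ S_d, since L α = R α forces α = (0,0).)
pairEq : ∀ {d} → Pair d → Pair d → ℕ
pairEq (a , b) (c , e) with a ≟ c | b ≟ e
... | yes _ | yes _ = 1
... | _     | _     = 0

M : (d : ℕ) .{{_ : NonZero d}} → Vertex d → Vertex d → ℕ
M d (α , _) (β , _) with pairEq (L α) β | pairEq (R α) β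
... | 0 | 0 = 0
... | _ | _ = 1

allPairs : (d : ℕ) → List (Pair d)
allPairs d = cartesianProduct (allFin d) (allFin d)

allVertices : (d : ℕ) → List (Vertex d)
allVertices d = go (allPairs d)
  where
  go : List (Pair d) → List (Vertex d)
  go List.[] = List.[]
  go (p List.∷ ps) with gcd (gcd (toℕ (proj₁ p)) (toℕ (proj₂ p))) d ≟ℕ 1
  ... | yes e = (p , e) List.∷ go ps
  ... | no _  = go ps

Mpow : (d : ℕ) .{{_ : NonZero d}} → ℕ → Vertex d → Vertex d → ℕ
Mpow d zero α β = pairEq (proj₁ α) (proj₁ β)
Mpow d (suc N) α β = sum (map (λ γ → M d α γ * Mpow d N γ β) (allVertices d))

{-# OPTIONS --safe #-}
module Submission where

-- Every edge of 𝒢_d is undone by a walk of length d - 1, because L^d = R^d = id on pairs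
-- mod d; hence reachability in 𝒢_d is symmetric. Subtractive Euclid, performed with these
-- inverse walks, leads from (a, b) to (g, 0) for a common divisor g of a and b; a second run
-- from (g, 0) = (g, d) reaches (h, 0) with h dividing a, b and d, so h = 1 on S_d. Thus every
-- vertex reaches e₁ = (1, 0) and is reached from it, and the loop R e₁ = e₁ pads walks
-- through e₁ to every length beyond the sum of the (finitely many) distances to and from e₁.

open import Defs
open import Data.Nat using (ℕ; zero; suc; pred; _+_; _*_; _%_; _≤_; _≥_; _<_; s≤s; z≤n; NonZero)
open import Data.Nat.Properties
  using (≡-irrelevant; ≤-refl; ≤-trans; ≤-total; m≤m+n; m≤n+m; m+n≤o⇒n≤o; +-mono-≤; +-monoˡ-≤;
         +-comm; +-assoc; +-identityʳ; *-identityˡ; suc-pred; m≤n⇒∃[o]m+o≡n)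
  renaming (_≟_ to _≟ℕ_)
open import Data.Nat.DivMod using (_mod_; m%n<n; %-distribˡ-+; [m+kn]%n≡m%n; m<n⇒m%n≡m; n%n≡0; m*n%n≡0)
open import Data.Nat.Divisibility
  using (_∣_; _∣0; ∣-refl; ∣-trans; ∣1⇒≡1; ∣m∣n⇒∣m+n; ∣m+n∣m⇒∣n; ∣n∣m%n⇒∣m)
open import Data.Nat.GCD using (gcd; gcd[m,n]∣m; gcd[m,n]∣n; gcd-greatest)
open import Data.Nat.ListAction using (sum)
open import Data.Nat.Tactic.RingSolver using (solve-∀)
open import Data.Fin using (Fin; toℕ)
open import Data.Fin.Properties using (_≟_; toℕ-fromℕ<; fromℕ<-toℕ; fromℕ<-cong; toℕ<n)
open import Data.Product using (Σ; ∃-syntax; _×_; _,_; proj₁; proj₂)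
open import Data.Sum as Sum using (_⊎_; inj₁; inj₂)
open import Data.List using (List; _∷_; map)
open import Data.List.Membership.Propositional using (_∈_)
open import Data.List.Membership.Propositional.Properties using (∈-map⁺; ∈-cartesianProduct⁺; ∈-allFin)
open import Data.List.Relation.Unary.Any using (here; there)
open import Data.Empty using (⊥-elim)
open import Function using (_∘_)
open import Relation.Nullary using (yes; no)
open import Relation.Binary.PropositionalEquality
  using (_≡_; refl; sym; trans; cong; cong₂; subst; subst₂; module ≡-Reasoning)

∈⇒≤sum : ∀ {n ns} → n ∈ ns → n ≤ sum ns
∈⇒≤sum {ns = n ∷ ns} (here refl)  = m≤m+n n (sum ns)
∈⇒≤sum {ns = m ∷ ns} (there n∈ns) = ≤-trans (∈⇒≤sum n∈ns) (m≤n+m (sum ns) m)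

∣gcd-gcd : ∀ {c a b n} → c ∣ a → c ∣ b → c ∣ n → c ∣ gcd (gcd a b) n
∣gcd-gcd c∣a c∣b c∣n = gcd-greatest (gcd-greatest c∣a c∣b) c∣n

gcd-gcd≡1-transfer : ∀ a b x y {n} →
  (∀ {c} → c ∣ x → c ∣ y → c ∣ n → c ∣ a × c ∣ b) →
  gcd (gcd a b) n ≡ 1 → gcd (gcd x y) n ≡ 1
gcd-gcd≡1-transfer a b x y {n} common gcd≡1 =
  let G∣a , G∣b = common (∣-trans G∣gcd (gcd[m,n]∣m x y)) (∣-trans G∣gcd (gcd[m,n]∣n x y)) G∣n
  in ∣1⇒≡1 (subst (G ∣_) gcd≡1 (∣gcd-gcd G∣a G∣b G∣n))
  where
  G = gcd (gcd x y) n
  G∣gcd = gcd[m,n]∣m (gcd x y) n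
  G∣n = gcd[m,n]∣n (gcd x y) n

m+k≡n⊎n+k≡m : ∀ m n → (∃[ k ] m + k ≡ n) ⊎ (∃[ k ] n + k ≡ m)
m+k≡n⊎n+k≡m m n =
  Sum.map (λ m≤n → m≤n⇒∃[o]m+o≡n m≤n) (λ n≤m → m≤n⇒∃[o]m+o≡n n≤m) (≤-total m n)

k*a+[a+b]≡b+a*[1+k] : ∀ k a b → k * a + (a + b) ≡ b + a * suc k
k*a+[a+b]≡b+a*[1+k] = solve-∀

k*a+[a+b]≡[1+k]*a+b : ∀ k a b → k * a + (a + b) ≡ suc k * a + b
k*a+[a+b]≡[1+k]*a+b = solve-∀

k*b+[a+b]≡[1+k]*b+a : ∀ k a b → k * b + (a + b) ≡ suc k * b + a
k*b+[a+b]≡[1+k]*b+a = solve-∀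

-- filterS names the local function `go` of allVertices: its meta is solved by unfolding
-- allVertices d once allPairs d has been abstracted.
mutual
  filterS : (d : ℕ) → List (Pair d) → List (Vertex d)
  filterS = _

  allVertices≡filterS : ∀ d → allVertices d ≡ filterS d (allPairs d)
  allVertices≡filterS d with allPairs d
  ... | _ = refl

∈-filterS : ∀ {d} {p : Pair d} (s : inS p) {ps} → p ∈ ps → (p , s) ∈ filterS d ps
∈-filterS {d} s {q ∷ ps} p∈q∷ps with gcd (gcd (toℕ (proj₁ q)) (toℕ (proj₂ q))) d ≟ℕ 1 | p∈q∷ps
... | yes s′ | here refl  = here (cong (_ ,_) (≡-irrelevant s s′))
... | no ¬s  | here refl  = ⊥-elim (¬s s)
... | yes _  | there p∈ps = there (∈-filterS s p∈ps)
... | no _   | there p∈ps = ∈-filterS s p∈ps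

allVertices-complete : ∀ {d} (α : Vertex d) → α ∈ allVertices d
allVertices-complete {d} ((i , j) , s) = subst (_ ∈_) (sym (allVertices≡filterS d))
  (∈-filterS s (∈-cartesianProduct⁺ (∈-allFin i) (∈-allFin j)))

pairEq-refl : ∀ {d} (p : Pair d) → pairEq p p ≡ 1
pairEq-refl (a , b) with a ≟ a | b ≟ b
... | yes _  | yes _  = refl
... | no a≢a | _      = ⊥-elim (a≢a refl)
... | yes _  | no b≢b = ⊥-elim (b≢b refl)

module _ {d : ℕ} .{{_ : NonZero d}} where

  ∣⊕⇒∣+ : ∀ {c} (i j : Fin d) → c ∣ d → c ∣ toℕ (i ⊕ j) → c ∣ toℕ i + toℕ j
  ∣⊕⇒∣+ i j c∣d c∣i⊕j = ∣n∣m%n⇒∣m c∣d (subst (_ ∣_) (toℕ-fromℕ< _) c∣i⊕j)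

  inS-L : (p : Pair d) → inS p → inS (L p)
  inS-L (i , j) = gcd-gcd≡1-transfer (toℕ i) (toℕ j) (toℕ i) (toℕ (i ⊕ j))
    λ c∣i c∣i⊕j c∣d →
      c∣i , ∣m+n∣m⇒∣n (∣⊕⇒∣+ i j c∣d c∣i⊕j) c∣i

  inS-R : (p : Pair d) → inS p → inS (R p)
  inS-R (i , j) = gcd-gcd≡1-transfer (toℕ i) (toℕ j) (toℕ (i ⊕ j)) (toℕ j)
    λ {c} c∣i⊕j c∣j c∣d →
      ∣m+n∣m⇒∣n (subst (c ∣_) (+-comm (toℕ i) (toℕ j)) (∣⊕⇒∣+ i j c∣d c∣i⊕j)) c∣j , c∣j

  mod-cong : ∀ {a b} → a % d ≡ b % d → a mod d ≡ b mod d
  mod-cong eq = fromℕ<-cong _ _ eq _ _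

  toℕ-mod : (i : Fin d) → toℕ i mod d ≡ i
  toℕ-mod i = trans (fromℕ<-cong _ _ (m<n⇒m%n≡m (toℕ<n i)) _ (toℕ<n i)) (fromℕ<-toℕ i (toℕ<n i))

  mod-⊕ : ∀ a b → (a mod d) ⊕ (b mod d) ≡ (a + b) mod d
  mod-⊕ a b = mod-cong (begin
    (toℕ (a mod d) + toℕ (b mod d)) % d ≡⟨ cong (_% d) (cong₂ _+_ (toℕ-fromℕ< (m%n<n a d))
                                                                    (toℕ-fromℕ< (m%n<n b d))) ⟩
    (a % d + b % d) % d                 ≡⟨ sym (%-distribˡ-+ a b d) ⟩
    (a + b) % d                         ∎)
    where open ≡-Reasoning

  ⟦_,_⟧ : ℕ → ℕ → Pair d
  ⟦ a , b ⟧ = a mod d , b mod d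

  ⟦toℕ,toℕ⟧ : (p : Pair d) → ⟦ toℕ (proj₁ p) , toℕ (proj₂ p) ⟧ ≡ p
  ⟦toℕ,toℕ⟧ (i , j) = cong₂ _,_ (toℕ-mod i) (toℕ-mod j)

  ⟦⟧-congˡ : ∀ {a a′} b → a % d ≡ a′ % d → ⟦ a , b ⟧ ≡ ⟦ a′ , b ⟧
  ⟦⟧-congˡ b eq = cong (_, b mod d) (mod-cong eq)

  ⟦⟧-congʳ : ∀ a {b b′} → b % d ≡ b′ % d → ⟦ a , b ⟧ ≡ ⟦ a , b′ ⟧
  ⟦⟧-congʳ a eq = cong (a mod d ,_) (mod-cong eq)

  L⟦⟧ : ∀ a b → L ⟦ a , b ⟧ ≡ ⟦ a , a + b ⟧
  L⟦⟧ a b = cong (a mod d ,_) (mod-⊕ a b)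

  R⟦⟧ : ∀ a b → R ⟦ a , b ⟧ ≡ ⟦ a + b , b ⟧
  R⟦⟧ a b = cong (_, b mod d) (mod-⊕ a b)

  Step : Pair d → Pair d → Set
  Step p q = L p ≡ q ⊎ R p ≡ q

  inS-step : ∀ {p q : Pair d} → Step p q → inS p → inS q
  inS-step {p} (inj₁ refl) = inS-L p
  inS-step {p} (inj₂ refl) = inS-R p

  infixr 5 _◅_ _◅◅_

  data Walk : ℕ → Pair d → Pair d → Set where
    ε   : ∀ {p} → Walk 0 p p
    _◅_ : ∀ {n p q r} → Step p q → Walk n q r → Walk (suc n) p r

  _◅◅_ : ∀ {m n p q r} → Walk m p q → Walk n q r → Walk (m + n) p r
  ε        ◅◅ v = v
  (s ◅ w) ◅◅ v = s ◅ (w ◅◅ v)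

  L-iterate : ∀ n a b → Walk n ⟦ a , b ⟧ ⟦ a , n * a + b ⟧
  L-iterate zero    a b = ε
  L-iterate (suc n) a b = inj₁ (L⟦⟧ a b) ◅
    subst (Walk n _) (cong ⟦ a ,_⟧ (k*a+[a+b]≡[1+k]*a+b n a b)) (L-iterate n a (a + b))

  R-iterate : ∀ n a b → Walk n ⟦ a , b ⟧ ⟦ n * b + a , b ⟧
  R-iterate zero    a b = ε
  R-iterate (suc n) a b = inj₂ (R⟦⟧ a b) ◅
    subst (Walk n _) (cong ⟦_, b ⟧ (k*b+[a+b]≡[1+k]*b+a n a b)) (R-iterate n (a + b) b)

  pred[d]*a+[a+b]%d≡b%d : ∀ a b → (pred d * a + (a + b)) % d ≡ b % d
  pred[d]*a+[a+b]%d≡b%d a b = begin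
    (pred d * a + (a + b)) % d  ≡⟨ cong (_% d) (k*a+[a+b]≡b+a*[1+k] (pred d) a b) ⟩
    (b + a * suc (pred d)) % d  ≡⟨ cong (λ n → (b + a * n) % d) (suc-pred d) ⟩
    (b + a * d) % d             ≡⟨ [m+kn]%n≡m%n b a d ⟩
    b % d                       ∎
    where open ≡-Reasoning

  L⁻¹⟦⟧ : ∀ a b → Walk (pred d) ⟦ a , a + b ⟧ ⟦ a , b ⟧
  L⁻¹⟦⟧ a b = subst (Walk _ _) (⟦⟧-congʳ a (pred[d]*a+[a+b]%d≡b%d a b))
    (L-iterate (pred d) a (a + b))

  R⁻¹⟦⟧ : ∀ a b → Walk (pred d) ⟦ a + b , b ⟧ ⟦ a , b ⟧
  R⁻¹⟦⟧ a b = subst (Walk _ _) (⟦⟧-congˡ b (trans (cong (λ x → (pred d * b + x) % d) (+-comm a b))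
                                                  (pred[d]*a+[a+b]%d≡b%d b a)))
    (R-iterate (pred d) (a + b) b)

  L⁻¹ : (p : Pair d) → Walk (pred d) (L p) p
  L⁻¹ p = subst₂ (Walk _) (trans (sym (L⟦⟧ _ _)) (cong L (⟦toℕ,toℕ⟧ p))) (⟦toℕ,toℕ⟧ p)
    (L⁻¹⟦⟧ (toℕ (proj₁ p)) (toℕ (proj₂ p)))

  R⁻¹ : (p : Pair d) → Walk (pred d) (R p) p
  R⁻¹ p = subst₂ (Walk _) (trans (sym (R⟦⟧ _ _)) (cong R (⟦toℕ,toℕ⟧ p))) (⟦toℕ,toℕ⟧ p)
    (R⁻¹⟦⟧ (toℕ (proj₁ p)) (toℕ (proj₂ p)))

  Step⁻¹ : ∀ {p q} → Step p q → Walk (pred d) q p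
  Step⁻¹ {p} (inj₁ refl) = L⁻¹ p
  Step⁻¹ {p} (inj₂ refl) = R⁻¹ p

  infix 4 _⇝_

  _⇝_ : Pair d → Pair d → Set
  p ⇝ q = ∃[ n ] Walk n p q

  ⇝-refl : ∀ {p} → p ⇝ p
  ⇝-refl = 0 , ε

  ⇝-trans : ∀ {p q r} → p ⇝ q → q ⇝ r → p ⇝ r
  ⇝-trans (m , w) (n , v) = m + n , w ◅◅ v

  reverse : ∀ {n p q} → Walk n p q → q ⇝ p
  reverse ε       = ⇝-refl
  reverse (s ◅ w) = ⇝-trans (reverse w) (pred d , Step⁻¹ s)

  euclid : ∀ a b → ∃[ g ] (g ∣ a × g ∣ b × ⟦ a , b ⟧ ⇝ ⟦ g , 0 ⟧)
  euclid a b = go (a + b) a b ≤-refl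
    where
    go : ∀ n a b → a + b ≤ n → ∃[ g ] (g ∣ a × g ∣ b × ⟦ a , b ⟧ ⇝ ⟦ g , 0 ⟧)
    go _ a zero _ = a , ∣-refl , a ∣0 , ⇝-refl
    go _ zero (suc b) _ =
      let sb,sb⇝sb,0 = subst (λ x → ⟦ suc b , x ⟧ ⇝ ⟦ suc b , 0 ⟧) (+-identityʳ (suc b))
                         (pred d , L⁻¹⟦⟧ (suc b) 0)
      in suc b , suc b ∣0 , ∣-refl , ⇝-trans (1 , inj₂ (R⟦⟧ 0 (suc b)) ◅ ε) sb,sb⇝sb,0
    go (suc n) (suc a) (suc b) (s≤s fuel) with m+k≡n⊎n+k≡m a b
    ... | inj₁ (c , refl) =
      let g , g∣a , g∣c , w = go n (suc a) c (m+n≤o⇒n≤o a fuel)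
      in g , g∣a , ∣m∣n⇒∣m+n g∣a g∣c , ⇝-trans (pred d , L⁻¹⟦⟧ (suc a) c) w
    ... | inj₂ (c , refl) =
      let g , g∣c , g∣b , w = go n c (suc b) (≤-trans (+-monoˡ-≤ (suc b) (m≤n+m c b)) fuel)
          sb+c⇝c,sb = subst (λ x → ⟦ x , suc b ⟧ ⇝ ⟦ c , suc b ⟧) (+-comm c (suc b))
                        (pred d , R⁻¹⟦⟧ c (suc b))
      in g , ∣m∣n⇒∣m+n g∣b g∣c , g∣b , ⇝-trans sb+c⇝c,sb w

  e₁ : Pair d
  e₁ = ⟦ 1 , 0 ⟧

  ⇝e₁ : (α : Vertex d) → proj₁ α ⇝ e₁
  ⇝e₁ (p , gcd≡1) =
    let a = toℕ (proj₁ p) ; b = toℕ (proj₂ p)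
        g , g∣a , g∣b , ab⇝g0 = euclid a b
        h , h∣g , h∣d , gd⇝h0 = euclid g d
        h≡1 = ∣1⇒≡1 (subst (h ∣_) gcd≡1 (∣gcd-gcd (∣-trans h∣g g∣a) (∣-trans h∣g g∣b) h∣d))
        g0≡gd = ⟦⟧-congʳ g (trans (m*n%n≡0 0 d) (sym (n%n≡0 d)))
    in subst₂ _⇝_ (⟦toℕ,toℕ⟧ p) (cong ⟦_, 0 ⟧ h≡1)
         (⇝-trans ab⇝g0 (subst (_⇝ ⟦ h , 0 ⟧) (sym g0≡gd) gd⇝h0))

  e₁⇝ : (α : Vertex d) → e₁ ⇝ proj₁ α
  e₁⇝ α = reverse (proj₂ (⇝e₁ α))

  e₁-loops : ∀ n → Walk n e₁ e₁
  e₁-loops zero    = ε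
  e₁-loops (suc n) = inj₂ (R⟦⟧ 1 0) ◅ e₁-loops n

  via-e₁ : ∀ {m k n p q} → Walk m p e₁ → Walk k e₁ q → m + k ≤ n → Walk n p q
  via-e₁ {m} {k} {p = p} {q} w v m+k≤n with m≤n⇒∃[o]m+o≡n m+k≤n
  ... | l , refl = subst (λ n → Walk n p q) length≡ (w ◅◅ e₁-loops l ◅◅ v)
    where
    length≡ : m + (l + k) ≡ m + k + l
    length≡ = trans (cong (m +_) (+-comm l k)) (sym (+-assoc m k l))

  M-step : ∀ {p q : Pair d} (s : inS p) (t : inS q) → Step p q → M d (p , s) (q , t) ≡ 1
  M-step {p} s t (inj₁ refl) rewrite pairEq-refl (L p) = refl
  M-step {p} s t (inj₂ refl) with pairEq (L p) (R p)
  ... | zero  rewrite pairEq-refl (R p) = refl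
  ... | suc _ = refl

  Walk⇒0<Mpow : ∀ {n p} (s : inS p) (β : Vertex d) → Walk n p (proj₁ β) → 0 < Mpow d n (p , s) β
  Walk⇒0<Mpow {p = p} s (_ , _) ε rewrite pairEq-refl p = s≤s z≤n
  Walk⇒0<Mpow {suc n} {p} s β (_◅_ {q = q} st w) =
    ≤-trans 0<term (∈⇒≤sum (∈-map⁺ (λ γ → M d (p , s) γ * Mpow d n γ β) (allVertices-complete (q , t))))
    where
    t = inS-step st s
    0<term : 0 < M d (p , s) (q , t) * Mpow d n (q , t) β
    0<term rewrite M-step s t st | *-identityˡ (Mpow d n (q , t) β) = Walk⇒0<Mpow t β w

lemma4p5 : (d : ℕ) → .{{_ : NonZero d}} → d ≥ 2 →
    Σ ℕ (λ N₀ → (N : ℕ) → N ≥ N₀ → (α β : Vertex d) → 0 < Mpow d N α β)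
lemma4p5 d _ = sumOver (proj₁ ∘ ⇝e₁) + sumOver (proj₁ ∘ e₁⇝) , λ N N≥N₀ α β →
  Walk⇒0<Mpow (proj₂ α) β
    (via-e₁ (proj₂ (⇝e₁ α)) (proj₂ (e₁⇝ β))
      (≤-trans (+-mono-≤ (≤sumOver _ α) (≤sumOver _ β)) N≥N₀))
  where
  sumOver : (Vertex d → ℕ) → ℕ
  sumOver f = sum (map f (allVertices d))

  ≤sumOver : ∀ f α → f α ≤ sumOver f
  ≤sumOver f α = ∈⇒≤sum (∈-map⁺ f (allVertices-complete α))
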